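{- Let $\mathcal{M}$ be a 4-orbit $(n-1)$-maniplex and $i\in\{0,\dots,n-1\}$ such that $\mathcal{M}$ has two orbits of $i$-faces and $T^i(\mathcal{M})$ has one connected component consisting of one vertex and another consisting of three vertices. Then either $T^{i-1}(\mathcal{M})$ or $T^{i+1}(\mathcal{M})$ has exactly two connected components, each with two vertices.
   Context: An $(n-1)$-maniplex is given by a connected simple graph (flag graph), whose vertices are called flags, with a proper edge-colouring by colours $\{0,\dots,n-1\}$, each colour class a perfect matching, such that for colours $i,j$ with $|i-j|\ge2$ each component of the subgraph spanned by colours $i,j$ is a 4-cycle. Automorphisms are colour-preserving graph automorphisms; 4-orbit means exactly 4 orbits on flags. An $i$-face is a connected component of the flag graph with the $i$-edges removed. The symmetry type graph $T(\mathcal{M})$ has as vertices the $\mathrm{Aut}(\mathcal{M})$-orbits of flags, an edge of colour $a$ between distinct orbits $B,C$ iff some flag of $B$ is $a$-adjacent to a flag of $C$, and a semi-edge of colour $a$ at $B$ iff some flag of $B$ is $a$-adjacent to a flag of $B$. For a colour $k$, $T^k(\mathcal{M})$ is $T(\mathcal{M})$ with all edges and semi-edges of colour $k$ removed; its components correspond to the orbits of $k$-faces. -}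

module Defs where

open import Data.Nat using (ℕ; zero; suc; _+_; _≤_; _<_; _∸_)
open import Data.Fin using (Fin; toℕ)
open import Data.Product using (Σ; ∃; _×_; _,_)
open import Data.Sum using (_⊎_)
open import Data.Unit using (⊤)
open import Relation.Nullary using (¬_)
open import Relation.Binary.PropositionalEquality using (_≡_; _≢_)

data Walk {n : ℕ} {Flag : Set} (adj : Fin n → Flag → Flag)
          (allowed : Fin n → Set) : Flag → Flag → Set where
  here : ∀ {x} → Walk adj allowed x x
  edge : ∀ {x y} (a : Fin n) → allowed a → Walk adj allowed (adj a x) y →
         Walk adj allowed x y

FarApart : {n : ℕ} → Fin n → Fin n → Set
FarApart i j = (toℕ i + 2 ≤ toℕ j) ⊎ (toℕ j + 2 ≤ toℕ i)

-- An (n-1)-maniplex, given by its flag graph.  The colour-i perfect matching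
-- is the fixed-point-free involution  adj i ; simplicity of the graph means
-- no loops (adj-noloop) and no two edges of different colours joining the
-- same pair of flags (adj-simple).  For |i-j| ≥ 2 the alternating i,j-walk
-- from any flag closes after 4 steps (adj-square); together with the
-- simplicity conditions this says every {i,j}-component is a 4-cycle.
record Maniplex (n : ℕ) : Set₁ where
  field
    Flag       : Set
    adj        : Fin n → Flag → Flag
    adj-invol  : ∀ i x → adj i (adj i x) ≡ x
    adj-noloop : ∀ i x → adj i x ≢ x
    adj-simple : ∀ i j x → adj i x ≡ adj j x → i ≡ j
    adj-square : ∀ i j → FarApart i j → ∀ x →
                 adj i (adj j (adj i (adj j x))) ≡ x
    connected  : ∀ x y → Walk adj (λ _ → ⊤) x y

module _ {n : ℕ} (M : Maniplex n) where
  open Maniplex M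

  record Automorphism : Set where
    field
      fun      : Flag → Flag
      inv      : Flag → Flag
      inv-left : ∀ x → inv (fun x) ≡ x
      inv-right : ∀ x → fun (inv x) ≡ x
      preserves : ∀ i x → fun (adj i x) ≡ adj i (fun x)

  SameOrbit : Flag → Flag → Set
  SameOrbit x y = Σ Automorphism λ f → Automorphism.fun f x ≡ y

  ExactlyClasses : (Flag → Flag → Set) → ℕ → Set
  ExactlyClasses R m =
    Σ (Fin m → Flag) λ v →
      (∀ j l → R (v j) (v l) → j ≡ l) × (∀ y → ∃ λ j → R (v j) y)

  OrbitCount : ℕ → Set
  OrbitCount m = ExactlyClasses SameOrbit m

  SameFace : ℕ → Flag → Flag → Set
  SameFace k x y = Walk adj (λ a → toℕ a ≢ k) x y

  SameFaceOrbit : ℕ → Flag → Flag → Set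
  SameFaceOrbit k x y = Σ Automorphism λ f → SameFace k (Automorphism.fun f x) y

  -- Connectivity in T^k(M), lifted to flags: the orbits of x and y lie in
  -- the same connected component of T(M) with colour-k (semi-)edges removed.
  data TConn (k : ℕ) : Flag → Flag → Set where
    orb   : ∀ {x y} → SameOrbit x y → TConn k x y
    step  : ∀ {x} (a : Fin n) → toℕ a ≢ k → TConn k x (adj a x)
    tsym  : ∀ {x y} → TConn k x y → TConn k y x
    ttrans : ∀ {x y z} → TConn k x y → TConn k y z → TConn k x z

  CompSize : ℕ → Flag → ℕ → Set
  CompSize k x s =
    Σ (Fin s → Flag) λ v →
      (∀ j → TConn k x (v j)) ×
      (∀ j l → SameOrbit (v j) (v l) → j ≡ l) ×
      (∀ y → TConn k x y → ∃ λ j → SameOrbit (v j) y)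

  TwoCompsOfTwo : ℕ → Set
  TwoCompsOfTwo k = ExactlyClasses (TConn k) 2 × (∀ x → CompSize k x 2)

-- Let A be the orbit forming the one-vertex component of T^i, x a flag of A and
-- b = x·i, with orbit B ≠ A.  Every colour j ≠ i preserves A, so a colour j ≠ i
-- moving B cannot commute with i (else b·j = x·j·i ~ x·i = b), i.e. j = i ± 1.
-- Not both i - 1 and i + 1 move B: if b·(i-1) and b·(i+1) lie in one orbit C,
-- then B ∪ C is closed under the colours ≠ i, leaving out the third orbit of the
-- component of B in T^i; otherwise A, B, C = b·(i-1), D = b·(i+1) are all four
-- orbits and the fourth corner b·(i-1)·(i+1) of the commuting square lies in
-- none of them.  As B is not a whole component of T^i, exactly one colour
-- a = i ± 1 moves B, and then T^a has the two components {A, B} (joined by i)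
-- and {b·a, Z}, Z the last orbit.
module Submission where

open import Defs
import Data.Nat as ℕ
open import Data.Nat using (ℕ; zero; suc; _+_; _∸_; _≤_; _<_; _≤?_; z≤n; s≤s)
open import Data.Nat.Properties using (≤-reflexive; +-comm; ≤-trans; n≤1+n; m≤n⇒m≤1+n; m+1+n≰m; 1+n≰n; <⇒≱; suc-injective)
open import Data.Fin using (Fin; toℕ; zero; suc; _≟_)
open import Data.Fin.Properties using (toℕ-injective; toℕ<n; any?; injective⇒≤)
open import Data.Vec.Functional using ([]; _∷_)
open import Data.Product using (Σ; ∃; _×_; _,_; proj₁; proj₂; swap)
open import Data.Sum using (_⊎_; inj₁; inj₂)
import Data.Sum as Sum
open import Data.Empty using (⊥; ⊥-elim)
open import Data.Unit using (⊤)
open import Function using (_∘_)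
open import Relation.Nullary using (¬_; Dec; yes; no; ¬?; contradiction)
open import Relation.Nullary.Decidable using (_×-dec_; _⊎-dec_)
open import Relation.Binary.PropositionalEquality

FarApartℕ : ℕ → ℕ → Set
FarApartℕ m t = (m + 2 ≤ t) ⊎ (t + 2 ≤ m)

farApartℕ⇒≢ : ∀ {m t} → FarApartℕ m t → m ≢ t
farApartℕ⇒≢ {m} (inj₁ m+2≤m) refl = m+1+n≰m m m+2≤m
farApartℕ⇒≢ {m} (inj₂ m+2≤m) refl = m+1+n≰m m m+2≤m

farApartℕ? : ∀ m t → Dec (FarApartℕ m t)
farApartℕ? m t = (m + 2 ≤? t) ⊎-dec (t + 2 ≤? m)

farApartℕ-sym : ∀ {m t} → FarApartℕ m t → FarApartℕ t m
farApartℕ-sym = Sum.swap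

¬farApartℕ⇒adjacent : ∀ {m t} → m ≢ t → ¬ FarApartℕ m t → suc m ≡ t ⊎ m ≡ suc t
¬farApartℕ⇒adjacent {zero}        {zero}        m≢t _    = contradiction refl m≢t
¬farApartℕ⇒adjacent {zero}        {suc zero}    _   _    = inj₁ refl
¬farApartℕ⇒adjacent {zero}        {suc (suc t)} _   near = contradiction (inj₁ (s≤s (s≤s z≤n))) near
¬farApartℕ⇒adjacent {suc zero}    {zero}        _   _    = inj₂ refl
¬farApartℕ⇒adjacent {suc (suc m)} {zero}        _   near = contradiction (inj₂ (s≤s (s≤s z≤n))) near
¬farApartℕ⇒adjacent {suc m}       {suc t}       m≢t near =
  Sum.map (cong suc) (cong suc)
    (¬farApartℕ⇒adjacent (m≢t ∘ cong suc) (near ∘ Sum.map s≤s s≤s))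

neighbours-farApartℕ : ∀ {m t m′} → suc m ≡ t → m′ ≡ suc t → FarApartℕ m m′
neighbours-farApartℕ {m} refl refl = inj₁ (≤-reflexive (+-comm m 2))

farApartℕ-from-middle : ∀ {j m t m′} → suc m ≡ t → m′ ≡ suc t →
                        FarApartℕ j t → FarApartℕ j m ⊎ FarApartℕ j m′
farApartℕ-from-middle refl refl (inj₁ j+2≤t) = inj₂ (inj₁ (m≤n⇒m≤1+n j+2≤t))
farApartℕ-from-middle refl refl (inj₂ t+2≤j) = inj₁ (inj₂ (≤-trans (n≤1+n _) t+2≤j))

below-or-above : ∀ {n} (Q : ℕ → Set) (a i : Fin n) → toℕ a ≢ toℕ i → ¬ FarApart a i →
                 Q (toℕ a) →
                 ((1 ≤ toℕ i) × Q (toℕ i ∸ 1)) ⊎ ((suc (toℕ i) < n) × Q (suc (toℕ i)))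
below-or-above {n} Q a i a≢i near q with ¬farApartℕ⇒adjacent a≢i near
... | inj₁ below = inj₁ (subst (1 ≤_) below (s≤s z≤n) , subst Q (cong (_∸ 1) below) q)
... | inj₂ above = inj₂ (subst (_< n) above (toℕ<n a) , subst Q above q)

module Properties {n : ℕ} (M : Maniplex n) where
  open Maniplex M

  adj-comm : ∀ a b → FarApart a b → ∀ u → adj a (adj b u) ≡ adj b (adj a u)
  adj-comm a b far u = begin
    adj a (adj b u)                                 ≡⟨ cong (λ w → adj a (adj b w)) (sym (adj-invol a u)) ⟩
    adj a (adj b (adj a (adj a u)))                 ≡⟨ cong (λ w → adj a (adj b (adj a w))) (sym (adj-invol b (adj a u))) ⟩
    adj a (adj b (adj a (adj b (adj b (adj a u))))) ≡⟨ adj-square a b far (adj b (adj a u)) ⟩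
    adj b (adj a u)                                 ∎
    where open ≡-Reasoning

  infix 4 _~_
  _~_ : Flag → Flag → Set
  _~_ = SameOrbit M

  ~-refl : ∀ {u} → u ~ u
  ~-refl = identity , refl
    where
      identity : Automorphism M
      identity = record
        { fun = λ u → u ; inv = λ u → u ; inv-left = λ _ → refl ; inv-right = λ _ → refl
        ; preserves = λ _ _ → refl }

  ~-sym : ∀ {u w} → u ~ w → w ~ u
  ~-sym {u} (f , fu≡w) = inverse , trans (cong inv (sym fu≡w)) (inv-left u)
    where
      open Automorphism f
      inverse : Automorphism M
      inverse = record
        { fun = inv ; inv = fun ; inv-left = inv-right ; inv-right = inv-left
        ; preserves = λ a u → begin
            inv (adj a u)             ≡⟨ cong (inv ∘ adj a) (sym (inv-right u)) ⟩
            inv (adj a (fun (inv u))) ≡⟨ cong inv (sym (preserves a (inv u))) ⟩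
            inv (fun (adj a (inv u))) ≡⟨ inv-left (adj a (inv u)) ⟩
            adj a (inv u)             ∎ }
        where open ≡-Reasoning

  ~-trans : ∀ {u v w} → u ~ v → v ~ w → u ~ w
  ~-trans (f , fu≡v) (g , gv≡w) = composite , trans (cong G.fun fu≡v) gv≡w
    where
      module F = Automorphism f
      module G = Automorphism g
      composite : Automorphism M
      composite = record
        { fun = G.fun ∘ F.fun ; inv = F.inv ∘ G.inv
        ; inv-left = λ u → trans (cong F.inv (G.inv-left (F.fun u))) (F.inv-left u)
        ; inv-right = λ u → trans (cong G.fun (F.inv-right (G.inv u))) (G.inv-right u)
        ; preserves = λ a u → trans (cong G.fun (F.preserves a u)) (G.preserves a (F.fun u)) }

  ~-adj : ∀ a {u w} → u ~ w → adj a u ~ adj a w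
  ~-adj a {u} (f , fu≡w) = f , trans (Automorphism.preserves f a u) (cong (adj a) fu≡w)

  fixed-commuting : ∀ {j e u} → FarApart j e → u ~ adj j u → adj e u ~ adj j (adj e u)
  fixed-commuting {j} {e} {u} far u~ju =
    subst (adj e u ~_) (sym (adj-comm j e far u)) (~-adj e u~ju)

  InOrbits : ∀ {k} → (Fin k → Flag) → Flag → Set
  InOrbits v u = ∃ λ j → v j ~ u

  Distinct : ∀ {k} → (Fin k → Flag) → Set
  Distinct v = ∀ j l → v j ~ v l → j ≡ l

  []-distinct : Distinct []
  []-distinct ()

  ∷-distinct : ∀ {k u} {v : Fin k → Flag} → Distinct v → ¬ InOrbits v u → Distinct (u ∷ v)
  ∷-distinct d new zero    zero    _ = refl
  ∷-distinct d new zero    (suc l) e = contradiction (l , ~-sym e) new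
  ∷-distinct d new (suc j) zero    e = contradiction (j , e) new
  ∷-distinct d new (suc j) (suc l) e = cong suc (d j l e)

  pair-distinct : ∀ {p q} → ¬ p ~ q → Distinct (p ∷ q ∷ [])
  pair-distinct p≁q =
    ∷-distinct (∷-distinct []-distinct λ { (() , _) }) λ { (zero , q~p) → p≁q (~-sym q~p) }

  OrbitInvariant : (Flag → Set) → Set
  OrbitInvariant P = ∀ {u w} → u ~ w → P u → P w

  ~-orbitInvariant : ∀ u → OrbitInvariant (u ~_)
  ~-orbitInvariant u v~w u~v = ~-trans u~v v~w

  InOrbits-invariant : ∀ {k} (v : Fin k → Flag) → OrbitInvariant (InOrbits v)
  InOrbits-invariant v u~w (j , e) = j , ~-trans e u~w

  StepClosed : ℕ → (Flag → Set) → Set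
  StepClosed k P = ∀ {u} j → toℕ j ≢ k → P u → P (adj j u)

  Walk-closed : ∀ {allowed} (P : Flag → Set) → (∀ {u} a → allowed a → P u → P (adj a u)) →
                ∀ {u w} → Walk adj allowed u w → P u → P w
  Walk-closed P closed here         p = p
  Walk-closed P closed (edge a ok w) p = Walk-closed P closed w (closed a ok p)

  TConn-closed : ∀ {k} (P : Flag → Set) → OrbitInvariant P → StepClosed k P →
                 ∀ {u w} → TConn M k u w → P u → P w
  TConn-closed {k} P invariant closed = proj₁ ∘ both
    where
      both : ∀ {u w} → TConn M k u w → (P u → P w) × (P w → P u)
      both (orb e)          = invariant e , invariant (~-sym e)
      both (step {u} j j≢k) = closed j j≢k , subst P (adj-invol j u) ∘ closed j j≢k
      both (tsym c)         = swap (both c)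
      both (ttrans c d)     = let f , g = both c ; f′ , g′ = both d in f′ ∘ f , g ∘ g′

  compSize-pair : ∀ {k u} p q → ¬ p ~ q → TConn M k u p → TConn M k p q →
                  (∀ w → TConn M k u w → InOrbits (p ∷ q ∷ []) w) → CompSize M k u 2
  compSize-pair p q p≁q u-p p-q covers = p ∷ q ∷ [] , connected′ , pair-distinct p≁q , covers
    where
      connected′ : ∀ j → TConn M _ _ ((p ∷ q ∷ []) j)
      connected′ zero       = u-p
      connected′ (suc zero) = ttrans u-p p-q

module Counting {n : ℕ} (M : Maniplex n) {m : ℕ} (orbits : OrbitCount M m) where
  open Maniplex M
  open Properties M

  private
    rep : Fin m → Flag
    rep = proj₁ orbits
    rep-distinct : Distinct rep
    rep-distinct = proj₁ (proj₂ orbits)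
    class : Flag → Fin m
    class u = proj₁ (proj₂ (proj₂ orbits) u)
    rep-class : ∀ u → rep (class u) ~ u
    rep-class u = proj₂ (proj₂ (proj₂ orbits) u)

  same-class⇒~ : ∀ {u w} → class u ≡ class w → u ~ w
  same-class⇒~ {u} {w} e = ~-trans (~-sym (rep-class u)) (subst (λ c → rep c ~ w) (sym e) (rep-class w))

  ~-dec : ∀ u w → Dec (u ~ w)
  ~-dec u w with class u ≟ class w
  ... | yes e = yes (same-class⇒~ e)
  ... | no ne = no λ u~w → ne (rep-distinct _ _ (~-trans (rep-class u) (~-trans u~w (~-sym (rep-class w)))))

  InOrbits-dec : ∀ {k} (v : Fin k → Flag) u → Dec (InOrbits v u)
  InOrbits-dec v u = any? (λ j → ~-dec (v j) u)

  distinct⇒≤ : ∀ {k} {v : Fin k → Flag} → Distinct v → k ≤ m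
  distinct⇒≤ {v = v} d = injective⇒≤ {f = class ∘ v} λ e → d _ _ (same-class⇒~ e)

  distinct-covers : {v : Fin m → Flag} → Distinct v → ∀ u → InOrbits v u
  distinct-covers {v} d u with InOrbits-dec v u
  ... | yes covered = covered
  ... | no  new     = contradiction (distinct⇒≤ (∷-distinct d new)) 1+n≰n

  orbit-outside : ∀ {k} (v : Fin k → Flag) → k < m → ∃ λ u → ¬ InOrbits v u
  orbit-outside v k<m with any? (λ j → ¬? (InOrbits-dec v (rep j)))
  ... | yes found    = rep (proj₁ found) , proj₂ found
  ... | no  all-hit = contradiction (injective⇒≤ index-injective) (<⇒≱ k<m)
    where
      hit : ∀ j → InOrbits v (rep j)
      hit j with InOrbits-dec v (rep j)
      ... | yes h = h
      ... | no  h = contradiction (j , h) all-hit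
      index-injective : ∀ {j l} → proj₁ (hit j) ≡ proj₁ (hit l) → j ≡ l
      index-injective {j} {l} e =
        rep-distinct j l (~-trans (~-sym (proj₂ (hit j))) (subst (λ c → v c ~ rep l) (sym e) (proj₂ (hit l))))

module TwoPairs {n : ℕ} (M : Maniplex n) (orbits : OrbitCount M 4) (k : ℕ)
                (p q r s : Maniplex.Flag M) (distinct : Properties.Distinct M (p ∷ q ∷ r ∷ s ∷ []))
                (p-q : TConn M k p q) (r-s : TConn M k r s)
                (rs-closed : Properties.StepClosed M k (Properties.InOrbits M (r ∷ s ∷ []))) where
  open Maniplex M
  open Properties M
  open Counting M orbits

  PQ RS : Flag → Set
  PQ = InOrbits (p ∷ q ∷ [])
  RS = InOrbits (r ∷ s ∷ [])

  side : ∀ u → PQ u ⊎ RS u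
  side u with distinct-covers distinct u
  ... | zero , e                   = inj₁ (zero , e)
  ... | suc zero , e               = inj₁ (suc zero , e)
  ... | suc (suc zero) , e         = inj₂ (zero , e)
  ... | suc (suc (suc zero)) , e   = inj₂ (suc zero , e)

  disjoint : ∀ {u} → PQ u → RS u → ⊥
  disjoint (zero , e)     (zero , e′)     = contradiction (distinct zero (suc (suc zero)) (~-trans e (~-sym e′))) λ ()
  disjoint (zero , e)     (suc zero , e′) = contradiction (distinct zero (suc (suc (suc zero))) (~-trans e (~-sym e′))) λ ()
  disjoint (suc zero , e) (zero , e′)     = contradiction (distinct (suc zero) (suc (suc zero)) (~-trans e (~-sym e′))) λ ()
  disjoint (suc zero , e) (suc zero , e′) = contradiction (distinct (suc zero) (suc (suc (suc zero))) (~-trans e (~-sym e′))) λ ()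

  RS-preserved : ∀ {u w} → TConn M k u w → RS u → RS w
  RS-preserved = TConn-closed RS (InOrbits-invariant (r ∷ s ∷ [])) rs-closed

  reach : ∀ {a b u} → TConn M k a b → InOrbits (a ∷ b ∷ []) u → TConn M k a u
  reach a-b (zero , e)     = orb e
  reach a-b (suc zero , e) = ttrans a-b (orb e)

  classes : ExactlyClasses M (TConn M k) 2
  classes = p ∷ r ∷ [] , separated , covered
    where
      separated : ∀ j l → TConn M k ((p ∷ r ∷ []) j) ((p ∷ r ∷ []) l) → j ≡ l
      separated zero       zero       _   = refl
      separated (suc zero) (suc zero) _   = refl
      separated zero       (suc zero) p-r = ⊥-elim (disjoint (zero , ~-refl) (RS-preserved (tsym p-r) (zero , ~-refl)))
      separated (suc zero) zero       r-p = ⊥-elim (disjoint (zero , ~-refl) (RS-preserved r-p (zero , ~-refl)))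
      covered : ∀ u → ∃ λ j → TConn M k ((p ∷ r ∷ []) j) u
      covered u with side u
      ... | inj₁ pq = zero , reach p-q pq
      ... | inj₂ rs = suc zero , reach r-s rs

  compSize : ∀ u → CompSize M k u 2
  compSize u with side u
  ... | inj₁ pq = compSize-pair p q (λ e → contradiction (distinct zero (suc zero) e) λ ())
                    (tsym (reach p-q pq)) p-q stays
    where
      stays : ∀ w → TConn M k u w → PQ w
      stays w u-w with side w
      ... | inj₁ pq′ = pq′
      ... | inj₂ rs′ = ⊥-elim (disjoint pq (RS-preserved (tsym u-w) rs′))
  ... | inj₂ rs = compSize-pair r s (λ e → contradiction (distinct (suc (suc zero)) (suc (suc (suc zero))) e) λ ())
                    (tsym (reach r-s rs)) r-s (λ _ u-w → RS-preserved u-w rs)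

  twoCompsOfTwo : TwoCompsOfTwo M k
  twoCompsOfTwo = classes , compSize

module OneAndThree {n : ℕ} (M : Maniplex n) (i : Fin n) (orbits : OrbitCount M 4)
                   (x y : Maniplex.Flag M) (x≁y : ¬ TConn M (toℕ i) x y)
                   (x-comp : CompSize M (toℕ i) x 1) (y-comp : CompSize M (toℕ i) y 3) where
  open Maniplex M
  open Properties M
  open Counting M orbits

  t : ℕ
  t = toℕ i

  y-orbits : Fin 3 → Flag
  y-orbits = proj₁ y-comp

  y-orbits-connected : ∀ j → TConn M t y (y-orbits j)
  y-orbits-connected = proj₁ (proj₂ y-comp)

  y-orbits-distinct : Distinct y-orbits
  y-orbits-distinct = proj₁ (proj₂ (proj₂ y-comp))

  b : Flag
  b = adj i x

  Moves : Fin n → Set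
  Moves a = ¬ b ~ adj a b

  x-component-orbit : ∀ {u} → TConn M t x u → x ~ u
  x-component-orbit x-u with proj₂ (proj₂ (proj₂ x-comp)) _ (orb ~-refl) | proj₂ (proj₂ (proj₂ x-comp)) _ x-u
  ... | zero , e | zero , e′ = ~-trans (~-sym e) e′

  x-orbit-closed : StepClosed t (x ~_)
  x-orbit-closed j j≢i x~u = x-component-orbit (ttrans (orb x~u) (step j j≢i))

  x≁b : ¬ x ~ b
  x≁b x~b = x≁y (orb (Walk-closed (x ~_) closed (connected x y) ~-refl))
    where
      closed : ∀ {u} a → ⊤ → x ~ u → x ~ adj a u
      closed a _ x~u with a ≟ i
      ... | yes refl = ~-trans x~b (~-adj i x~u)
      ... | no  a≢i  = x-orbit-closed a (a≢i ∘ toℕ-injective) x~u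

  y-orbits-avoid-x : ¬ InOrbits y-orbits x
  y-orbits-avoid-x (j , e) = x≁y (tsym (ttrans (y-orbits-connected j) (orb e)))

  outside-x-orbit⇒y-component : ∀ {u} → ¬ x ~ u → TConn M t y u
  outside-x-orbit⇒y-component x≁u
    with distinct-covers (∷-distinct y-orbits-distinct y-orbits-avoid-x) _
  ... | zero  , x~u = contradiction x~u x≁u
  ... | suc j , e   = ttrans (y-orbits-connected j) (orb e)

  closure-of-b-covers-outside-x-orbit : (S : Flag → Set) → OrbitInvariant S → StepClosed t S →
                                        S b → ∀ {u} → ¬ x ~ u → S u
  closure-of-b-covers-outside-x-orbit S invariant closed Sb x≁u =
    TConn-closed S invariant closed
      (ttrans (tsym (outside-x-orbit⇒y-component x≁b)) (outside-x-orbit⇒y-component x≁u)) Sb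

  farApart-fixes-b : ∀ j → FarApart j i → b ~ adj j b
  farApart-fixes-b j far = fixed-commuting far (x-orbit-closed j (farApartℕ⇒≢ far) ~-refl)

  moves⇒¬farApart : ∀ {a} → Moves a → ¬ FarApart a i
  moves⇒¬farApart moves = moves ∘ farApart-fixes-b _

  x≁adj-b : ∀ {a} → toℕ a ≢ t → ¬ x ~ adj a b
  x≁adj-b {a} a≢i x~ab = x≁b (subst (x ~_) (adj-invol a b) (x-orbit-closed a a≢i x~ab))

  three-orbits : ∀ {a} → toℕ a ≢ t → Moves a → Distinct (adj a b ∷ b ∷ x ∷ [])
  three-orbits a≢i moves =
    ∷-distinct (∷-distinct (∷-distinct []-distinct λ { (() , _) }) λ { (zero , x~b) → x≁b x~b })
      λ { (zero , b~ab) → moves b~ab ; (suc zero , x~ab) → x≁adj-b a≢i x~ab }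

  fourth-orbit : ∀ a → ∃ λ z → ¬ InOrbits (adj a b ∷ b ∷ x ∷ []) z
  fourth-orbit a = orbit-outside (adj a b ∷ b ∷ x ∷ []) (s≤s (s≤s (s≤s (s≤s z≤n))))

  module Neighbours (a a′ : Fin n) (below : suc (toℕ a) ≡ t) (above : toℕ a′ ≡ suc t) where
    c d : Flag
    c = adj a b
    d = adj a′ b

    a≢i : toℕ a ≢ t
    a≢i a≡i = 1+n≰n (≤-reflexive (trans below (sym a≡i)))

    a′≢i : toℕ a′ ≢ t
    a′≢i a′≡i = 1+n≰n (≤-reflexive (trans (sym above) a′≡i))

    classify : ∀ j → toℕ j ≢ t → j ≡ a ⊎ j ≡ a′ ⊎ (FarApart j i × (FarApart j a ⊎ FarApart j a′))
    classify j j≢i with j ≟ a | j ≟ a′ | farApartℕ? (toℕ j) t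
    ... | yes j≡a | _        | _        = inj₁ j≡a
    ... | no _    | yes j≡a′ | _        = inj₂ (inj₁ j≡a′)
    ... | no _    | no _     | yes far  = inj₂ (inj₂ (far , farApartℕ-from-middle below above far))
    ... | no j≢a  | no j≢a′  | no  near with ¬farApartℕ⇒adjacent j≢i near
    ...   | inj₁ j+1≡i = contradiction (toℕ-injective (suc-injective (trans j+1≡i (sym below)))) j≢a
    ...   | inj₂ j≡i+1 = contradiction (toℕ-injective (trans j≡i+1 (sym above))) j≢a′

    moved-corners-differ : Moves a → ¬ c ~ d
    moved-corners-differ moves c~d =
      z∉S (closure-of-b-covers-outside-x-orbit S (InOrbits-invariant (b ∷ c ∷ [])) closed (zero , ~-refl) x≁z)
      where
        S : Flag → Set
        S = InOrbits (b ∷ c ∷ [])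
        x≁z : ¬ x ~ proj₁ (fourth-orbit a)
        x≁z x~z = proj₂ (fourth-orbit a) (suc (suc zero) , x~z)
        z∉S : ¬ S (proj₁ (fourth-orbit a))
        z∉S (zero , b~z)     = proj₂ (fourth-orbit a) (suc zero , b~z)
        z∉S (suc zero , c~z) = proj₂ (fourth-orbit a) (zero , c~z)
        closed : StepClosed t S
        closed {u} j j≢i Su with classify j j≢i | Su
        ... | inj₁ refl | zero , b~u = suc zero , ~-adj a b~u
        ... | inj₁ refl | suc zero , c~u = zero , subst (_~ adj a u) (adj-invol a b) (~-adj a c~u)
        ... | inj₂ (inj₁ refl) | zero , b~u = suc zero , ~-trans c~d (~-adj a′ b~u)
        ... | inj₂ (inj₁ refl) | suc zero , c~u =
          zero , ~-trans (subst (_~ adj a′ c) (adj-invol a′ b) (~-adj a′ (~-sym c~d))) (~-adj a′ c~u)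
        ... | inj₂ (inj₂ (far , _)) | zero , b~u = zero , ~-trans (farApart-fixes-b j far) (~-adj j b~u)
        ... | inj₂ (inj₂ (far , inj₁ far-a)) | suc zero , c~u =
          suc zero , ~-trans (fixed-commuting far-a (farApart-fixes-b j far)) (~-adj j c~u)
        ... | inj₂ (inj₂ (far , inj₂ far-a′)) | suc zero , c~u =
          suc zero , ~-trans c~d (~-trans (fixed-commuting far-a′ (farApart-fixes-b j far))
                                   (~-trans (~-sym (~-adj j c~d)) (~-adj j c~u)))

    corner : adj a (adj a′ c) ≡ d
    corner = begin
      adj a (adj a′ (adj a b)) ≡⟨ cong (adj a) (adj-comm a′ a (farApartℕ-sym (neighbours-farApartℕ below above)) b) ⟩
      adj a (adj a (adj a′ b)) ≡⟨ adj-invol a d ⟩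
      d                        ∎
      where open ≡-Reasoning

    four-orbits : Moves a → Moves a′ → Distinct (d ∷ c ∷ b ∷ x ∷ [])
    four-orbits moves moves′ = ∷-distinct (three-orbits a≢i moves) λ
      { (zero , c~d) → moved-corners-differ moves c~d
      ; (suc zero , b~d) → moves′ b~d
      ; (suc (suc zero) , x~d) → x≁adj-b a′≢i x~d }

    not-both-move : Moves a → Moves a′ → ⊥
    not-both-move moves moves′ with distinct-covers (four-orbits moves moves′) (adj a′ c)
    ... | zero , d~w                 = moves (subst₂ _~_ (adj-invol a′ b) (adj-invol a′ c) (~-adj a′ d~w))
    ... | suc zero , c~w             = moves′ (subst₂ _~_ (adj-invol a b) corner (~-adj a c~w))
    ... | suc (suc zero) , b~w       = moved-corners-differ moves (subst (c ~_) corner (~-adj a b~w))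
    ... | suc (suc (suc zero)) , x~w = x≁adj-b a≢i (subst (x ~_) (adj-invol a′ c) (x-orbit-closed a′ a′≢i x~w))

  at-most-one-moves : ∀ {a a′} → a ≢ a′ → toℕ a ≢ t → toℕ a′ ≢ t → Moves a → Moves a′ → ⊥
  at-most-one-moves {a} {a′} a≢a′ a≢i a′≢i moves moves′
    with ¬farApartℕ⇒adjacent a≢i (moves⇒¬farApart moves) | ¬farApartℕ⇒adjacent a′≢i (moves⇒¬farApart moves′)
  ... | inj₁ below | inj₂ above  = Neighbours.not-both-move a a′ below above moves moves′
  ... | inj₂ above | inj₁ below  = Neighbours.not-both-move a′ a below above moves′ moves
  ... | inj₁ below | inj₁ below′ = a≢a′ (toℕ-injective (suc-injective (trans below (sym below′))))
  ... | inj₂ above | inj₂ above′ = a≢a′ (toℕ-injective (trans above (sym above′)))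

  some-colour-moves : ∃ λ a → toℕ a ≢ t × Moves a
  some-colour-moves with any? (λ a → ¬? (toℕ a ℕ.≟ t) ×-dec ¬? (~-dec b (adj a b)))
  ... | yes found = found
  ... | no  none  = contradiction (y-orbits-distinct zero (suc zero) (~-trans (~-sym (in-b-orbit zero)) (in-b-orbit (suc zero)))) λ ()
    where
      fixes : ∀ j → toℕ j ≢ t → b ~ adj j b
      fixes j j≢i with ~-dec b (adj j b)
      ... | yes fixed = fixed
      ... | no  moves = contradiction (j , j≢i , moves) none
      in-b-orbit : ∀ j → b ~ y-orbits j
      in-b-orbit j = closure-of-b-covers-outside-x-orbit (b ~_) (~-orbitInvariant b)
        (λ l l≢i b~u → ~-trans (fixes l l≢i) (~-adj l b~u)) ~-refl
        (λ x~w → y-orbits-avoid-x (j , ~-sym x~w))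

  module MovingColour (a : Fin n) (a≢i : toℕ a ≢ t) (moves : Moves a) where
    c : Flag
    c = adj a b

    others-fix-b : ∀ j → toℕ j ≢ t → j ≢ a → b ~ adj j b
    others-fix-b j j≢i j≢a with ~-dec b (adj j b)
    ... | yes fixed  = fixed
    ... | no  moves′ = ⊥-elim (at-most-one-moves (j≢a ∘ sym) a≢i j≢i moves moves′)

    z : Flag
    z = proj₁ (fourth-orbit a)

    four-orbits : Distinct (z ∷ c ∷ b ∷ x ∷ [])
    four-orbits = ∷-distinct (three-orbits a≢i moves) (proj₂ (fourth-orbit a))

    c-z-connected : TConn M (toℕ a) c z
    c-z-connected with any? (λ j → ¬? (toℕ j ℕ.≟ t) ×-dec ¬? (j ≟ a) ×-dec ~-dec z (adj j c))
    ... | yes (j , _ , j≢a , z~jc) = ttrans (step j (j≢a ∘ toℕ-injective)) (orb (~-sym z~jc))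
    ... | no  none = contradiction
      (closure-of-b-covers-outside-x-orbit (InOrbits (c ∷ b ∷ x ∷ [])) (InOrbits-invariant _) closed
         (suc zero , ~-refl) (λ x~z → proj₂ (fourth-orbit a) (suc (suc zero) , x~z)))
      (proj₂ (fourth-orbit a))
      where
        closed : StepClosed t (InOrbits (c ∷ b ∷ x ∷ []))
        closed j j≢i (zero , c~u) with j ≟ a | distinct-covers four-orbits (adj j c)
        ... | yes refl | _            = suc zero , subst (_~ adj a _) (adj-invol a b) (~-adj a c~u)
        ... | no  j≢a  | zero , z~jc  = contradiction (j , j≢i , j≢a , z~jc) none
        ... | no  j≢a  | suc k , k~jc = k , ~-trans k~jc (~-adj j c~u)
        closed j j≢i (suc zero , b~u) with j ≟ a
        ... | yes refl = zero , ~-adj a b~u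
        ... | no  j≢a  = suc zero , ~-trans (others-fix-b j j≢i j≢a) (~-adj j b~u)
        closed j j≢i (suc (suc zero) , x~u) = suc (suc zero) , x-orbit-closed j j≢i x~u

    b-x-closed : StepClosed (toℕ a) (InOrbits (b ∷ x ∷ []))
    b-x-closed j j≢a bx with j ≟ i | bx
    ... | yes refl | zero , b~u     = suc zero , subst (_~ adj i _) (adj-invol i x) (~-adj i b~u)
    ... | yes refl | suc zero , x~u = zero , ~-adj i x~u
    ... | no  j≢i  | zero , b~u     = zero , ~-trans (others-fix-b j (j≢i ∘ toℕ-injective) (j≢a ∘ cong toℕ)) (~-adj j b~u)
    ... | no  j≢i  | suc zero , x~u = suc zero , x-orbit-closed j (j≢i ∘ toℕ-injective) x~u

    twoCompsOfTwo-at-a : TwoCompsOfTwo M (toℕ a)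
    twoCompsOfTwo-at-a = TwoPairs.twoCompsOfTwo M orbits (toℕ a) z c b x four-orbits
                           (tsym c-z-connected) (tsym (step i (a≢i ∘ sym))) b-x-closed

lemma4p6 : (n : ℕ) (M : Maniplex n) (i : Fin n) →
    OrbitCount M 4 →
    ExactlyClasses M (SameFaceOrbit M (toℕ i)) 2 →
    Σ (Maniplex.Flag M) (λ x → Σ (Maniplex.Flag M) (λ y →
    ¬ TConn M (toℕ i) x y × CompSize M (toℕ i) x 1 × CompSize M (toℕ i) y 3)) →
    ((1 ≤ toℕ i) × TwoCompsOfTwo M (toℕ i ∸ 1))
    ⊎ ((suc (toℕ i) < n) × TwoCompsOfTwo M (suc (toℕ i)))
-- The two orbits of i-faces are the two components of T^i, so that hypothesis is redundant.
lemma4p6 n M i orbits _ (x , y , x≁y , x-comp , y-comp) =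
  let a , a≢i , moves = some-colour-moves
  in below-or-above (TwoCompsOfTwo M) a i a≢i (moves⇒¬farApart moves)
                    (MovingColour.twoCompsOfTwo-at-a a a≢i moves)
  where open OneAndThree M i orbits x y x≁y x-comp y-comp
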